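{- Let $\Gamma$ and $\Gamma'$ be two paths in $B(\mathfrak S_n)$ lying in the same flipclass. Then the groups $W(\Gamma)$ and $W(\Gamma')$ coincide, the vertex sets of $G(\Gamma)$ and $G(\Gamma')$ coincide, and $G(\Gamma)$ and $G(\Gamma')$ have the same number of connected components.
   Context: $\mathfrak S_n$: symmetric group on $[n]$, $\ell$ Coxeter length, $T$ transpositions. Bruhat graph $B(\mathfrak S_n)$: edge $x\xrightarrow{t}y$ labelled $t$ whenever $yx^{ -1}=t\in T$ and $\ell(x)<\ell(y)$. $P_h(u,v)$: directed paths of length $h$ from $u$ to $v$. Between two elements there are 0 or 2 paths of length 2, each the flip of the other; $f_i$ replaces the subpath $x_{i-1}\to x_i\to x_{i+1}$ by its flip; flipclasses are orbits in $P_h(u,v)$ of the group generated by $f_1,\dots,f_{h-1}$. For a path $\Gamma$ with labels $t_1,\dots,t_h$: $W(\Gamma)$ is the subgroup of $\mathfrak S_n$ generated by $t_1,\dots,t_h$; $G(\Gamma)$ is the edge-labelled undirected multigraph whose vertex set is $\{a\in[n]:t_i(a)\ne a\text{ for some }i\}$, with an edge labelled $i$ between $a$ and $b$ whenever $t_i=(a,b)$. -}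

module Defs where

open import Data.Nat using (ℕ; zero; suc; _<_; _<ᵇ_)
open import Data.Bool using (Bool; true; false; if_then_else_; _∧_)
open import Data.Fin using (Fin; toℕ; inject₁) renaming (zero to fzero; suc to fsuc)
open import Data.Fin.Properties using (_≟_)
open import Data.Vec using (Vec; lookup; tabulate; head; last)
open import Data.List using (List; map; allFin)
open import Data.Nat.ListAction using (sum)
open import Data.Product using (Σ; ∃; ∃-syntax; _×_)
open import Relation.Nullary using (¬_; does)
open import Relation.Binary.PropositionalEquality using (_≡_; _≢_)
open import Relation.Binary.Construct.Closure.ReflexiveTransitive using (Star)

-- Elements of 𝔖_n in one-line notation: x is the vector (x(0),…,x(n-1)).
-- Vertices of paths are such vectors; a path starting at a permutation
-- stays inside 𝔖_n since every step multiplies by a transposition.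

Perm : ℕ → Set
Perm n = Vec (Fin n) n

-- x is a bijection of [n] (surjective, hence bijective on Fin n)
IsPerm : ∀ {n} → Perm n → Set
IsPerm {n} x = ∀ (b : Fin n) → ∃[ a ] lookup x a ≡ b

infixl 7 _·_
_·_ : ∀ {n} → Perm n → Perm n → Perm n
g · h = tabulate (λ a → lookup g (lookup h a))

idP : ∀ {n} → Perm n
idP = tabulate (λ a → a)

transp : ∀ {n} → Fin n → Fin n → Perm n
transp a b = tabulate (λ c → if does (c ≟ a) then b else (if does (c ≟ b) then a else c))

IsTransposition : ∀ {n} → Perm n → Set
IsTransposition {n} t = ∃[ a ] ∃[ b ] (a ≢ b × t ≡ transp a b)

-- Coxeter length = number of inversions
ℓ : ∀ {n} → Perm n → ℕ
ℓ {n} x = sum (map (λ i → sum (map (λ j →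
            if (toℕ i <ᵇ toℕ j) ∧ (toℕ (lookup x j) <ᵇ toℕ (lookup x i)) then 1 else 0)
          (allFin n))) (allFin n))

-- Bruhat graph edge x → y :  y x⁻¹ = t ∈ T  (i.e. y = t · x) and ℓ(x) < ℓ(y)
BEdge : ∀ {n} → Perm n → Perm n → Set
BEdge x y = ∃[ t ] (IsTransposition t × y ≡ t · x) × ℓ x < ℓ y

-- Paths of length h: vertex sequences x_0,…,x_h  (a Vec of length suc h)

vtx : ∀ {n h} → Vec (Perm n) (suc h) → Fin (suc h) → Perm n
vtx xs i = lookup xs i

IsPath : ∀ {n h} → Vec (Perm n) (suc h) → Set
IsPath {n} {h} xs = IsPerm (head xs)
  × (∀ (i : Fin h) → BEdge (lookup xs (inject₁ i)) (lookup xs (fsuc i)))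

InP : ∀ {n} (h : ℕ) → Perm n → Perm n → Vec (Perm n) (suc h) → Set
InP h u v xs = IsPath xs × head xs ≡ u × last xs ≡ v

-- Since
-- there are exactly 0 or 2 paths of length 2 between two elements, this is
-- exactly "Γ' is obtained from Γ by replacing x_{i-1}→x_i→x_{i+1} by its flip".
Flip : ∀ {n h} → Vec (Perm n) (suc h) → Vec (Perm n) (suc h) → Set
Flip {n} {h} xs ys = IsPath xs × IsPath ys ×
  ∃[ i ] (0 < toℕ i × toℕ i < h
          × lookup xs i ≢ lookup ys i
          × (∀ j → j ≢ i → lookup xs j ≡ lookup ys j))

-- same flipclass: orbit under ⟨f_1,…,f_{h-1}⟩ (each f_i an involution)
SameFlipclass : ∀ {n h} → Vec (Perm n) (suc h) → Vec (Perm n) (suc h) → Set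
SameFlipclass = Star Flip

-- Labels: t is the label t_{i+1} of the (i+1)-st edge, i.e. x_{i+1} x_i⁻¹ = t

Label : ∀ {n h} → Vec (Perm n) (suc h) → Fin h → Perm n → Set
Label xs i t = lookup xs (fsuc i) ≡ t · lookup xs (inject₁ i)

data Generated {n} (S : Perm n → Set) : Perm n → Set where
  gen : ∀ {g} → S g → Generated S g
  one : Generated S idP
  mul : ∀ {g h} → Generated S g → Generated S h → Generated S (g · h)
  inv : ∀ {g h} → Generated S g → h · g ≡ idP → Generated S h

W : ∀ {n h} → Vec (Perm n) (suc h) → Perm n → Set
W xs = Generated (λ t → ∃[ i ] Label xs i t)

GVertex : ∀ {n h} → Vec (Perm n) (suc h) → Fin n → Set
GVertex xs a = ∃[ i ] ∃[ t ] (Label xs i t × lookup t a ≢ a)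

GEdge : ∀ {n h} → Vec (Perm n) (suc h) → Fin n → Fin n → Set
GEdge xs a b = ∃[ i ] ∃[ t ] (Label xs i t × lookup t a ≡ b × a ≢ b)

GConnected : ∀ {n h} → Vec (Perm n) (suc h) → Fin n → Fin n → Set
GConnected xs = Star (GEdge xs)

HasComponents : ∀ {n h} → Vec (Perm n) (suc h) → ℕ → Set
HasComponents {n} xs k = ∃[ r ] (
    (∀ (j : Fin k) → GVertex xs (lookup {n = k} r j))
  × (∀ (j j′ : Fin k) → GConnected xs (lookup r j) (lookup r j′) → j ≡ j′)
  × (∀ a → GVertex xs a → ∃[ j ] GConnected xs a (lookup r j)))

{-# OPTIONS --safe #-}
-- A flip at x_i replaces the labels t₁, t₂ of x_{i-1} → x_i → x_{i+1} by labels s₁, s₂ with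
-- s₂ s₁ = t₂ t₁ = x_{i+1} x_{i-1}⁻¹ =: w, and w ≠ 1 because ℓ increases along a path.  When two
-- transpositions have a non-trivial product w, each pair {a, b} swapped by one of them satisfies
-- w a = b or w b = a, for otherwise both factors would be (a b).  Since c, t₁ c and t₂ t₁ c = w c
-- are connected in G(Γ), every edge of G(Γ′) joins vertices connected in G(Γ); and if a and b are
-- connected in G(Γ), then (a b) is an iterated conjugate of a label of Γ by labels of Γ, so it lies
-- in W(Γ).  Flips being symmetric, all three invariants transfer in both directions.

module Submission where

open import Defs
open import Data.Nat using (ℕ; suc; _<_)
open import Data.Nat.Properties using (<-irrefl; <-trans)
open import Data.Fin using (Fin; inject₁; fromℕ<) renaming (zero to fzero; suc to fsuc)
open import Data.Fin.Properties
  using (_≟_; toℕ-injective; toℕ-inject₁; toℕ-fromℕ<; suc-injective; inject₁-injective)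
open import Data.Fin.Induction using (<-weakInduction)
open import Data.Vec using (Vec; lookup; head; _∷_)
open import Data.Vec.Properties using (lookup∘tabulate)
open import Data.Vec.Relation.Binary.Pointwise.Extensional using (ext; Pointwise-≡⇒≡)
open import Data.Product using (_×_; _,_; ∃; proj₁; proj₂)
import Data.Product as Product
open import Data.Sum using (_⊎_; inj₁; inj₂; [_,_])
open import Data.Empty using (⊥-elim)
open import Data.Bool using (if_then_else_)
open import Function using (_∘_; id)
open import Function.Bundles using (_⇔_; mk⇔)
import Function.Properties.Equivalence as ⇔
open import Relation.Nullary using (¬_; Dec; yes; no; does)
open import Relation.Nullary.Decidable using (dec-true; dec-false)
open import Relation.Binary.PropositionalEquality
  using (_≡_; _≢_; refl; sym; trans; cong; subst; _≗_; module ≡-Reasoning)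
open import Relation.Binary.Construct.Closure.ReflexiveTransitive using (ε; _◅_; _◅◅_; reverse; _⋆)

private
  variable
    n h : ℕ
    a b c p q r : Fin n
    xs ys : Vec (Perm n) (suc h)

swap : Fin n → Fin n → Fin n → Fin n
swap a b c = if does (c ≟ a) then b else (if does (c ≟ b) then a else c)

lookup-transp : ∀ (a b c : Fin n) → lookup (transp a b) c ≡ swap a b c
lookup-transp a b = lookup∘tabulate (swap a b)

swap-fst : ∀ (a b : Fin n) → swap a b a ≡ b
swap-fst a b rewrite dec-true (a ≟ a) refl = refl

swap-snd : ∀ (a b : Fin n) → swap a b b ≡ a
swap-snd a b with b ≟ a
... | yes b≡a = b≡a
... | no _ rewrite dec-true (b ≟ b) refl = refl

swap-other : c ≢ a → c ≢ b → swap a b c ≡ c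
swap-other {c = c} {a} {b} c≢a c≢b rewrite dec-false (c ≟ a) c≢a | dec-false (c ≟ b) c≢b = refl

swap-moved : swap a b c ≢ c → c ≡ a ⊎ c ≡ b
swap-moved {a = a} {b} {c} moved with c ≟ a | c ≟ b
... | yes c≡a | _ = inj₁ c≡a
... | no _ | yes c≡b = inj₂ c≡b
... | no _ | no _ = ⊥-elim (moved refl)

swap-conjugate : p ≢ r → r ≢ q → p ≢ q → ∀ c → swap p r (swap r q (swap p r c)) ≡ swap p q c
swap-conjugate {p = p} {r} {q} p≢r r≢q p≢q c = by-cases (c ≟ p) (c ≟ r) (c ≟ q)
  where
  by-cases : Dec (c ≡ p) → Dec (c ≡ r) → Dec (c ≡ q) → swap p r (swap r q (swap p r c)) ≡ swap p q c
  by-cases (yes refl) _ _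
    rewrite swap-fst c r | swap-fst r q | swap-other (p≢q ∘ sym) (r≢q ∘ sym) | swap-fst c q = refl
  by-cases (no _) (yes refl) _
    rewrite swap-snd p c | swap-other p≢r p≢q | swap-fst p c | swap-other (p≢r ∘ sym) r≢q = refl
  by-cases (no _) (no _) (yes refl)
    rewrite swap-other (p≢q ∘ sym) (r≢q ∘ sym) | swap-snd r c | swap-snd p r | swap-snd p c = refl
  by-cases (no c≢p) (no c≢r) (no c≢q)
    rewrite swap-other c≢p c≢r | swap-other c≢r c≢q | swap-other c≢p c≢r | swap-other c≢p c≢q = refl

record IsIdOrTransposition (f : Fin n → Fin n) : Set where
  field
    involutive  : ∀ c → f (f c) ≡ c
    swaps-moved : ∀ {x y} → f x ≢ x → f y ≢ y → x ≢ y → f x ≡ y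

  fixes-others : f a ≡ b → a ≢ b → c ≢ a → c ≢ b → f c ≡ c
  fixes-others {a = a} {c = c} fa≡b a≢b c≢a c≢b with f c ≟ c
  ... | yes fixed = fixed
  ... | no moved = ⊥-elim (c≢b (trans (sym (swaps-moved a-moved moved (c≢a ∘ sym))) fa≡b))
    where
    a-moved : f a ≢ a
    a-moved fa≡a = a≢b (trans (sym fa≡a) fa≡b)

  ≗swap : f a ≡ b → a ≢ b → f ≗ swap a b
  ≗swap {a = a} {b} fa≡b a≢b c = by-cases (c ≟ a) (c ≟ b)
    where
    by-cases : Dec (c ≡ a) → Dec (c ≡ b) → f c ≡ swap a b c
    by-cases (yes refl) _ = trans fa≡b (sym (swap-fst a b))
    by-cases (no _) (yes refl) = trans (cong f (sym fa≡b)) (trans (involutive a) (sym (swap-snd a b)))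
    by-cases (no c≢a) (no c≢b) = trans (fixes-others fa≡b a≢b c≢a c≢b) (sym (swap-other c≢a c≢b))

IsIdOrTransposition-resp-≗ : ∀ {f g : Fin n → Fin n} →
                             f ≗ g → IsIdOrTransposition g → IsIdOrTransposition f
IsIdOrTransposition-resp-≗ {f = f} {g} f≗g g-t = record
  { involutive  = λ c → trans (f≗g (f c)) (trans (cong g (f≗g c)) (involutive c))
  ; swaps-moved = λ fx≢x fy≢y x≢y →
      trans (f≗g _) (swaps-moved (fx≢x ∘ trans (f≗g _)) (fy≢y ∘ trans (f≗g _)) x≢y)
  }
  where open IsIdOrTransposition g-t

swap-isIdOrTransposition : ∀ (a b : Fin n) → IsIdOrTransposition (swap a b)
swap-isIdOrTransposition a b = record { involutive = involutive ; swaps-moved = swaps-moved }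
  where
  involutive : ∀ c → swap a b (swap a b c) ≡ c
  involutive c with swap a b c ≟ c
  ... | yes fixed = trans (cong (swap a b) fixed) fixed
  ... | no moved with swap-moved moved
  ...   | inj₁ refl = trans (cong (swap c b) (swap-fst c b)) (swap-snd c b)
  ...   | inj₂ refl = trans (cong (swap a c) (swap-snd a c)) (swap-fst a c)
  swaps-moved : ∀ {x y} → swap a b x ≢ x → swap a b y ≢ y → x ≢ y → swap a b x ≡ y
  swaps-moved x-moved y-moved x≢y with swap-moved x-moved | swap-moved y-moved
  ... | inj₁ refl | inj₁ refl = ⊥-elim (x≢y refl)
  ... | inj₁ refl | inj₂ refl = swap-fst a b
  ... | inj₂ refl | inj₁ refl = swap-snd a b
  ... | inj₂ refl | inj₂ refl = ⊥-elim (x≢y refl)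

transposition-isIdOrTransposition : ∀ {t : Perm n} → IsTransposition t → IsIdOrTransposition (lookup t)
transposition-isIdOrTransposition (a , b , _ , refl) =
  IsIdOrTransposition-resp-≗ (lookup-transp a b) (swap-isIdOrTransposition a b)

Linked : (Fin n → Fin n) → Fin n → Fin n → Set
Linked w a b = w a ≡ b ⊎ w b ≡ a

module _ {f g : Fin n → Fin n} (f-t : IsIdOrTransposition f) (g-t : IsIdOrTransposition g)
         (g∘f≢id : ¬ (g ∘ f ≗ id)) where
  private
    module F = IsIdOrTransposition f-t
    module G = IsIdOrTransposition g-t

    same-swap⇒g∘f≗id : f a ≡ b → g a ≡ b → a ≢ b → g ∘ f ≗ id
    same-swap⇒g∘f≗id fa≡b ga≡b a≢b c =
      trans (cong g (trans (F.≗swap fa≡b a≢b c) (sym (G.≗swap ga≡b a≢b c)))) (G.involutive c)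

  swapped-by-first⇒Linked : f a ≡ b → a ≢ b → Linked (g ∘ f) a b
  swapped-by-first⇒Linked {a = a} {b} fa≡b a≢b with g b ≟ b | g a ≟ a
  ... | yes gb≡b | _ = inj₁ (trans (cong g fa≡b) gb≡b)
  ... | no _ | yes ga≡a = inj₂ (trans (cong g (trans (cong f (sym fa≡b)) (F.involutive a))) ga≡a)
  ... | no gb≢b | no ga≢a =
    ⊥-elim (g∘f≢id (same-swap⇒g∘f≗id fa≡b (G.swaps-moved ga≢a gb≢b a≢b) a≢b))

  swapped-by-second⇒Linked : g a ≡ b → a ≢ b → Linked (g ∘ f) a b
  swapped-by-second⇒Linked {a = a} {b} ga≡b a≢b with f a ≟ a | f b ≟ b
  ... | yes fa≡a | _ = inj₁ (trans (cong g fa≡a) ga≡b)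
  ... | no _ | yes fb≡b = inj₂ (trans (cong g fb≡b) (trans (cong g (sym ga≡b)) (G.involutive a)))
  ... | no fa≢a | no fb≢b =
    ⊥-elim (g∘f≢id (same-swap⇒g∘f≗id (F.swaps-moved fa≢a fb≢b a≢b) ga≡b a≢b))

lookup-· : ∀ (s t : Perm n) c → lookup (s · t) c ≡ lookup s (lookup t c)
lookup-· s t = lookup∘tabulate _

lookup-·-· : ∀ (s t u : Perm n) c → lookup (s · (t · u)) c ≡ lookup s (lookup t (lookup u c))
lookup-·-· s t u c = trans (lookup-· s (t · u) c) (cong (lookup s) (lookup-· t u c))

isPerm-· : ∀ {s t : Perm n} → IsPerm s → IsPerm t → IsPerm (s · t)
isPerm-· {s = s} {t} s-onto t-onto b =
  let b′ , sb′≡b = s-onto b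
      a , ta≡b′ = t-onto b′
  in a , trans (lookup-· s t a) (trans (cong (lookup s) ta≡b′) sb′≡b)

transposition-isPerm : ∀ {t : Perm n} → IsTransposition t → IsPerm t
transposition-isPerm {t = t} t-transp b =
  lookup t b , IsIdOrTransposition.involutive (transposition-isIdOrTransposition {t = t} t-transp) b

isPerm-cancelʳ : ∀ {x : Perm n} {f g : Fin n → Fin n} → IsPerm x →
                 (∀ a → f (lookup x a) ≡ g (lookup x a)) → f ≗ g
isPerm-cancelʳ x-onto f∘x≗g∘x c with x-onto c
... | a , refl = f∘x≗g∘x a

·-cancelʳ : ∀ {s t x : Perm n} → IsPerm x → s · x ≡ t · x → s ≡ t
·-cancelʳ {s = s} {t} {x} x-onto s·x≡t·x = Pointwise-≡⇒≡ (ext (isPerm-cancelʳ {x = x} x-onto λ a →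
  trans (sym (lookup-· s x a)) (trans (cong (λ v → lookup v a) s·x≡t·x) (lookup-· t x a))))

lookup-zero : ∀ {A : Set} (xs : Vec A (suc h)) → lookup xs fzero ≡ head xs
lookup-zero (_ ∷ _) = refl

inject₁≢suc : ∀ (i : Fin n) → inject₁ i ≢ fsuc i
inject₁≢suc fzero ()
inject₁≢suc (fsuc i) eq = inject₁≢suc i (suc-injective eq)

two-step : ∀ (xs : Vec (Perm n) (suc h)) {k k′ : Fin h} (t₁ t₂ : Perm n) →
           Label xs k t₁ → Label xs k′ t₂ → inject₁ k′ ≡ fsuc k →
           lookup xs (fsuc k′) ≡ t₂ · (t₁ · lookup xs (inject₁ k))
two-step xs t₁ t₂ l₁ l₂ consecutive =
  trans l₂ (cong (t₂ ·_) (trans (cong (lookup xs) consecutive) l₁))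

label-connected : ∀ (xs : Vec (Perm n) (suc h)) {e : Fin h} (t : Perm n) →
                  Label xs e t → ∀ c → GConnected xs c (lookup t c)
label-connected xs {e} t lab c with c ≟ lookup t c
... | yes c≡tc = subst (GConnected xs c) c≡tc ε
... | no c≢tc = (e , t , lab , refl , c≢tc) ◅ ε

GConnected⇒GVertex : ∀ {xs : Vec (Perm n) (suc h)} → GConnected xs a b → a ≢ b → GVertex xs a
GConnected⇒GVertex ε a≢a = ⊥-elim (a≢a refl)
GConnected⇒GVertex ((e , t , lab , ta≡b , a≢b) ◅ _) _ =
  e , t , lab , λ ta≡a → a≢b (trans (sym ta≡a) ta≡b)

transp-conjugate : p ≢ r → r ≢ q → p ≢ q → transp p r · (transp r q · transp p r) ≡ transp p q
transp-conjugate {p = p} {r} {q} p≢r r≢q p≢q = Pointwise-≡⇒≡ (ext λ c → begin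
  lookup (transp p r · (transp r q · transp p r)) c
    ≡⟨ lookup-·-· (transp p r) (transp r q) (transp p r) c ⟩
  lookup (transp p r) (lookup (transp r q) (lookup (transp p r) c))
    ≡⟨ cong (λ d → lookup (transp p r) (lookup (transp r q) d)) (lookup-transp p r c) ⟩
  lookup (transp p r) (lookup (transp r q) (swap p r c))
    ≡⟨ cong (lookup (transp p r)) (lookup-transp r q (swap p r c)) ⟩
  lookup (transp p r) (swap r q (swap p r c))
    ≡⟨ lookup-transp p r (swap r q (swap p r c)) ⟩
  swap p r (swap r q (swap p r c))
    ≡⟨ swap-conjugate p≢r r≢q p≢q c ⟩
  swap p q c
    ≡⟨ lookup-transp p q c ⟨
  lookup (transp p q) c ∎)
  where open ≡-Reasoning

module PathGraph (xs : Vec (Perm n) (suc h)) (path : IsPath xs) where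

  vertex-isPerm : ∀ i → IsPerm (lookup xs i)
  vertex-isPerm = <-weakInduction (IsPerm ∘ lookup xs)
    (subst IsPerm (sym (lookup-zero xs)) (proj₁ path)) step
    where
    step : ∀ i → IsPerm (lookup xs (inject₁ i)) → IsPerm (lookup xs (fsuc i))
    step i x-onto =
      let t , (t-transp , y≡t·x) , _ = proj₂ path i
      in subst IsPerm (sym y≡t·x)
           (isPerm-· {s = t} {t = lookup xs (inject₁ i)} (transposition-isPerm t-transp) x-onto)

  edge-label : ∀ e → ∃ (Label xs e)
  edge-label e = let t , (_ , y≡t·x) , _ = proj₂ path e in t , y≡t·x

  label-isTransposition : ∀ {e} s → Label xs e s → IsTransposition s
  label-isTransposition {e} s lab =
    let t , (t-transp , y≡t·x) , _ = proj₂ path e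
        t≡s = ·-cancelʳ {s = t} {x = lookup xs (inject₁ e)} (vertex-isPerm (inject₁ e)) (trans (sym y≡t·x) lab)
    in subst IsTransposition t≡s t-transp

  label-isIdOrTransposition : ∀ {e} s → Label xs e s → IsIdOrTransposition (lookup s)
  label-isIdOrTransposition s lab = transposition-isIdOrTransposition {t = s} (label-isTransposition s lab)

  two-step-≢ : ∀ {k k′} → inject₁ k′ ≡ fsuc k → lookup xs (fsuc k′) ≢ lookup xs (inject₁ k)
  two-step-≢ {k} {k′} consecutive x″≡x =
    <-irrefl (cong ℓ (sym x″≡x))
      (<-trans (ℓ-increases k)
               (subst (λ j → ℓ (lookup xs j) < ℓ (lookup xs (fsuc k′))) consecutive (ℓ-increases k′)))
    where
    ℓ-increases : ∀ e → ℓ (lookup xs (inject₁ e)) < ℓ (lookup xs (fsuc e))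
    ℓ-increases e = proj₂ (proj₂ (proj₂ path e))

  GEdge-sym : GEdge xs a b → GEdge xs b a
  GEdge-sym {a = a} (e , t , lab , ta≡b , a≢b) =
    e , t , lab , trans (cong (lookup t) (sym ta≡b)) (involutive a) , a≢b ∘ sym
    where open IsIdOrTransposition (label-isIdOrTransposition t lab)

  GConnected-sym : GConnected xs a b → GConnected xs b a
  GConnected-sym = reverse GEdge-sym

  GEdge⇒W : GEdge xs p q → W xs (transp p q)
  GEdge⇒W {p = p} {q} (e , t , lab , tp≡q , p≢q) = subst (W xs) t≡transp (gen (e , lab))
    where
    t≡transp : t ≡ transp p q
    t≡transp = Pointwise-≡⇒≡ (ext λ c →
      trans (IsIdOrTransposition.≗swap (label-isIdOrTransposition t lab) tp≡q p≢q c) (sym (lookup-transp p q c)))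

  GConnected⇒W : GConnected xs p q → p ≢ q → W xs (transp p q)
  GConnected⇒W ε p≢p = ⊥-elim (p≢p refl)
  GConnected⇒W {q = q} (_◅_ {j = r} pr@(_ , _ , _ , _ , p≢r) r⇝q) p≢q with r ≟ q
  ... | yes refl = GEdge⇒W pr
  ... | no r≢q = subst (W xs) (transp-conjugate p≢r r≢q p≢q)
                   (mul (GEdge⇒W pr) (mul (GConnected⇒W r⇝q r≢q) (GEdge⇒W pr)))

module FlipAt (xs ys : Vec (Perm n) (suc h)) (xs-path : IsPath xs) (ys-path : IsPath ys)
  {k k′ : Fin h} (consecutive : inject₁ k′ ≡ fsuc k)
  (agree : ∀ j → j ≢ fsuc k → lookup xs j ≡ lookup ys j) where

  private
    module X = PathGraph xs xs-path
    module Y = PathGraph ys ys-path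

    agree-start : lookup xs (inject₁ k) ≡ lookup ys (inject₁ k)
    agree-start = agree (inject₁ k) (inject₁≢suc k)

    agree-end : lookup xs (fsuc k′) ≡ lookup ys (fsuc k′)
    agree-end = agree (fsuc k′) λ k′+1≡k+1 →
      inject₁≢suc k (trans (cong inject₁ (sym (suc-injective k′+1≡k+1))) consecutive)

  composite-agrees : ∀ t₁ t₂ s₁ s₂ →
                     Label xs k t₁ → Label xs k′ t₂ → Label ys k s₁ → Label ys k′ s₂ →
                     lookup t₂ ∘ lookup t₁ ≗ lookup s₂ ∘ lookup s₁
  composite-agrees t₁ t₂ s₁ s₂ lx₁ lx₂ ly₁ ly₂ =
    isPerm-cancelʳ {x = u} (X.vertex-isPerm (inject₁ k)) λ a → begin
      lookup t₂ (lookup t₁ (lookup u a))   ≡⟨ lookup-·-· t₂ t₁ u a ⟨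
      lookup (t₂ · (t₁ · u)) a             ≡⟨ cong (λ v → lookup v a) same-end ⟩
      lookup (s₂ · (s₁ · u)) a             ≡⟨ lookup-·-· s₂ s₁ u a ⟩
      lookup s₂ (lookup s₁ (lookup u a))   ∎
    where
    open ≡-Reasoning
    u = lookup xs (inject₁ k)
    same-end : t₂ · (t₁ · u) ≡ s₂ · (s₁ · u)
    same-end = begin
      t₂ · (t₁ · u)                      ≡⟨ two-step xs t₁ t₂ lx₁ lx₂ consecutive ⟨
      lookup xs (fsuc k′)                ≡⟨ agree-end ⟩
      lookup ys (fsuc k′)                ≡⟨ two-step ys s₁ s₂ ly₁ ly₂ consecutive ⟩
      s₂ · (s₁ · lookup ys (inject₁ k))  ≡⟨ cong (λ v → s₂ · (s₁ · v)) agree-start ⟨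
      s₂ · (s₁ · u)                      ∎

  flipped-pair-connected : ∀ s₁ s₂ → Label ys k s₁ → Label ys k′ s₂ →
                           lookup s₁ a ≡ b ⊎ lookup s₂ a ≡ b → a ≢ b → GConnected xs a b
  flipped-pair-connected {a = a} {b} s₁ s₂ ly₁ ly₂ swapped a≢b =
    [ connected , X.GConnected-sym ∘ connected ] (linked swapped)
    where
    s₁-t = Y.label-isIdOrTransposition s₁ ly₁
    s₂-t = Y.label-isIdOrTransposition s₂ ly₂

    s₂∘s₁≢id : ¬ (lookup s₂ ∘ lookup s₁ ≗ id)
    s₂∘s₁≢id s₂∘s₁≗id = Y.two-step-≢ consecutive (trans (two-step ys s₁ s₂ ly₁ ly₂ consecutive)
      (Pointwise-≡⇒≡ (ext λ a →
        trans (lookup-·-· s₂ s₁ (lookup ys (inject₁ k)) a) (s₂∘s₁≗id (lookup (lookup ys (inject₁ k)) a)))))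

    linked : lookup s₁ a ≡ b ⊎ lookup s₂ a ≡ b → Linked (lookup s₂ ∘ lookup s₁) a b
    linked = [ (λ s₁a≡b → swapped-by-first⇒Linked s₁-t s₂-t s₂∘s₁≢id s₁a≡b a≢b)
             , (λ s₂a≡b → swapped-by-second⇒Linked s₁-t s₂-t s₂∘s₁≢id s₂a≡b a≢b) ]

    connected : ∀ {c d} → lookup s₂ (lookup s₁ c) ≡ d → GConnected xs c d
    connected {c} w≡d =
      let t₁ , lx₁ = X.edge-label k
          t₂ , lx₂ = X.edge-label k′
      in subst (GConnected xs c) (trans (composite-agrees t₁ t₂ s₁ s₂ lx₁ lx₂ ly₁ ly₂ c) w≡d)
           (label-connected xs t₁ lx₁ c ◅◅ label-connected xs t₂ lx₂ (lookup t₁ c))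

  GEdge-connected : GEdge ys a b → GConnected xs a b
  GEdge-connected (e , s , lab , sa≡b , a≢b) with e ≟ k | inject₁ e ≟ fsuc k
  ... | yes refl | _ =
    let s₂ , ly₂ = Y.edge-label k′
    in flipped-pair-connected s s₂ lab ly₂ (inj₁ sa≡b) a≢b
  ... | no _ | yes e-enters =
    let s₁ , ly₁ = Y.edge-label k
        e≡k′ = inject₁-injective (trans e-enters (sym consecutive))
    in flipped-pair-connected s₁ s ly₁ (subst (λ j → Label ys j s) e≡k′ lab) (inj₂ sa≡b) a≢b
  ... | no e≢k | no e-avoids = (e , s , lab-xs , sa≡b , a≢b) ◅ ε
    where
    lab-xs : Label xs e s
    lab-xs = trans (agree (fsuc e) (e≢k ∘ suc-injective))
                   (trans lab (cong (s ·_) (sym (agree (inject₁ e) e-avoids))))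

Flip-sym : Flip xs ys → Flip ys xs
Flip-sym (xs-path , ys-path , i , 0<i , i<h , xᵢ≢yᵢ , agree) =
  ys-path , xs-path , i , 0<i , i<h , xᵢ≢yᵢ ∘ sym , λ j j≢i → sym (agree j j≢i)

Flip⇒GEdge-connected : ∀ (xs ys : Vec (Perm n) (suc h)) → Flip xs ys → GEdge ys a b → GConnected xs a b
Flip⇒GEdge-connected _ _ (_ , _ , fzero , () , _)
Flip⇒GEdge-connected xs ys (xs-path , ys-path , fsuc k , _ , k+1<h , _ , agree) =
  FlipAt.GEdge-connected xs ys xs-path ys-path consecutive agree
  where
  consecutive : inject₁ (fromℕ< k+1<h) ≡ fsuc k
  consecutive = toℕ-injective (trans (toℕ-inject₁ _) (toℕ-fromℕ< k+1<h))

module FlipPullback (xs ys : Vec (Perm n) (suc h)) (flip : Flip xs ys) where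

  private
    module X = PathGraph xs (proj₁ flip)
    module Y = PathGraph ys (proj₁ (proj₂ flip))

  GConnected⊆ : GConnected ys a b → GConnected xs a b
  GConnected⊆ = Flip⇒GEdge-connected xs ys flip ⋆

  GVertex⊆ : GVertex ys a → GVertex xs a
  GVertex⊆ (e , s , lab , sa≢a) =
    GConnected⇒GVertex {xs = xs} (GConnected⊆ ((e , s , lab , refl , a≢sa) ◅ ε)) a≢sa
    where
    a≢sa = sa≢a ∘ sym

  W⊆ : ∀ {g} → W ys g → W xs g
  W⊆ (gen {g} (e , lab)) =
    let p , q , p≢q , g≡pq = Y.label-isTransposition g lab
        gp≡q = trans (cong (λ v → lookup v p) g≡pq) (trans (lookup-transp p q p) (swap-fst p q))
        p⇝q = GConnected⊆ ((e , g , lab , gp≡q , p≢q) ◅ ε)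
    in subst (W xs) (sym g≡pq) (X.GConnected⇒W p⇝q p≢q)
  W⊆ one = one
  W⊆ (mul g∈W h∈W) = mul (W⊆ g∈W) (W⊆ h∈W)
  W⊆ (inv g∈W hg≡1) = inv (W⊆ g∈W) hg≡1

HasComponents⊆ : ∀ {k} (xs ys : Vec (Perm n) (suc h)) → Flip xs ys → HasComponents ys k → HasComponents xs k
HasComponents⊆ xs ys flip (r , r-vertices , r-separated , r-covers) =
    r
  , Y⇒X.GVertex⊆ ∘ r-vertices
  , (λ j j′ → r-separated j j′ ∘ X⇒Y.GConnected⊆)
  , λ a a-vertex → Product.map₂ Y⇒X.GConnected⊆ (r-covers a (X⇒Y.GVertex⊆ a-vertex))
  where
  module Y⇒X = FlipPullback xs ys flip
  module X⇒Y = FlipPullback ys xs (Flip-sym {xs = xs} {ys} flip)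

SameFlipclass-invariant : ∀ (P : Vec (Perm n) (suc h) → Set) →
                          (∀ (xs′ ys′ : Vec (Perm n) (suc h)) → Flip xs′ ys′ → P ys′ → P xs′) →
                          SameFlipclass xs ys → P xs ⇔ P ys
SameFlipclass-invariant P pull-back ε = ⇔.refl
SameFlipclass-invariant P pull-back (_◅_ {i = xs} {j = zs} flip flips) =
  ⇔.trans (mk⇔ (pull-back zs xs (Flip-sym {xs = xs} {zs} flip)) (pull-back xs zs flip))
          (SameFlipclass-invariant P pull-back flips)

lemma6p1 : ∀ {n h : ℕ} (Γ Γ′ : Vec (Perm n) (suc h)) →
    IsPath Γ → SameFlipclass Γ Γ′ →
    (∀ g → W Γ g ⇔ W Γ′ g)
    × (∀ (a : Fin n) → GVertex Γ a ⇔ GVertex Γ′ a)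
    × (∀ (k : ℕ) → HasComponents Γ k ⇔ HasComponents Γ′ k)
lemma6p1 Γ Γ′ _ same =
    (λ g → SameFlipclass-invariant (λ Δ → W Δ g) (λ Δ Δ′ flip → FlipPullback.W⊆ Δ Δ′ flip) same)
  , (λ a → SameFlipclass-invariant (λ Δ → GVertex Δ a) (λ Δ Δ′ flip → FlipPullback.GVertex⊆ Δ Δ′ flip) same)
  , (λ k → SameFlipclass-invariant (λ Δ → HasComponents Δ k) HasComponents⊆ same)
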